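{- Let $h$ be an abstraction homomorphism generated by a total function $h:\Sigma\to\Sigma'\cup\{\varepsilon\}$, let $x'\in\Sigma'^\omega$, and let $x\in\Sigma^\omega$ with $h(x)=x'$. Let $\eta$ be a Boolean (containing no temporal operator) PLTL formula in $\Sigma'$-normal form. Then $x',\lambda_{\Sigma'}\models\eta$ if and only if $x,\lambda_{h_{\Sigma\Sigma'}}\models(\varepsilon)\,\mathcal U\,(N(\eta))$.
   Context: PLTL semantics for a labelling $\lambda:\Sigma\to 2^{AP}$ and $x=x_1x_2\cdots\in\Sigma^\omega$, with $x_{(i\ldots)}=x_ix_{i+1}\cdots$: $x,\lambda\models true$; $x,\lambda\models a$ iff $a\in\lambda(x_1)$; Boolean connectives as usual; $x,\lambda\models\bigcirc\xi$ iff $x_{(2\ldots)},\lambda\models\xi$; $x,\lambda\models\xi\,\mathcal U\,\zeta$ iff there is $i\ge1$ with $x_{(i\ldots)},\lambda\models\zeta$ and $x_{(j\ldots)},\lambda\models\xi$ for all $1\le j<i$. A formula is in $\Sigma'$-normal form if negations apply only to atomic propositions and all atomic propositions lie in $\Sigma'$. $\lambda_{\Sigma'}(a)=\{a\}$. The abstraction homomorphism extends $h$ letterwise; for $x\in\Sigma^\omega$, $h(x)=h(x_1)h(x_2)\cdots$ if this is infinite, undefined otherwise. $\lambda_{h_{\Sigma\Sigma'}}:\Sigma\to 2^{\Sigma'\cup\{\varepsilon\}}$, $a\mapsto\{h(a)\}$, where $\varepsilon$ is an atomic proposition true at a letter iff $h$ maps it to the empty word. $N(\eta)$ is obtained from $\eta$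 by replacing each subformula $\neg(a)$, $a$ atomic, by $(\neg a)\wedge(\neg\varepsilon)$. -}

module Defs where

open import Data.Nat using (ℕ; zero; suc; _+_; _<_)
open import Data.Maybe using (Maybe; just; nothing)
open import Data.Product using (Σ; ∃; _×_)
open import Data.Sum using (_⊎_)
open import Data.Empty using (⊥)
open import Data.Unit using (⊤)
open import Relation.Nullary using (¬_)
open import Relation.Binary.PropositionalEquality using (_≡_; _≢_)

-- ω-words over an alphabet A, indexed from 0 (position 0 = the paper's x₁)
ω-Word : Set → Set
ω-Word A = ℕ → A

-- suffix x_{(i+1 ...)} (0-based shift by i)
suffix : {A : Set} → ℕ → ω-Word A → ω-Word A
suffix i x n = x (i + n)

data Formula (AP : Set) : Set where
  tt    : Formula AP
  atom  : AP → Formula AP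
  ¬'_   : Formula AP → Formula AP
  _∧'_  : Formula AP → Formula AP → Formula AP
  _∨'_  : Formula AP → Formula AP → Formula AP
  ○_    : Formula AP → Formula AP
  _U_   : Formula AP → Formula AP → Formula AP

-- a labelling λ : Σ → 2^AP is given as a membership relation  p ∈ λ(a)
Labelling : Set → Set → Set₁
Labelling A AP = A → AP → Set

_,_⊨_ : {A AP : Set} → ω-Word A → Labelling A AP → Formula AP → Set
x , l ⊨ tt = ⊤
x , l ⊨ atom p = l (x 0) p
x , l ⊨ (¬' φ) = ¬ (x , l ⊨ φ)
x , l ⊨ (φ ∧' ψ) = (x , l ⊨ φ) × (x , l ⊨ ψ)
x , l ⊨ (φ ∨' ψ) = (x , l ⊨ φ) ⊎ (x , l ⊨ ψ)
x , l ⊨ (○ φ) = suffix 1 x , l ⊨ φ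
x , l ⊨ (φ U ψ) =
  Σ ℕ λ i → (suffix i x , l ⊨ ψ) × (∀ j → j < i → suffix j x , l ⊨ φ)

data Boolean {AP : Set} : Formula AP → Set where
  tt   : Boolean tt
  atom : ∀ p → Boolean (atom p)
  neg  : ∀ {φ} → Boolean φ → Boolean (¬' φ)
  and  : ∀ {φ ψ} → Boolean φ → Boolean ψ → Boolean (φ ∧' ψ)
  or   : ∀ {φ ψ} → Boolean φ → Boolean ψ → Boolean (φ ∨' ψ)

data NegNormal {AP : Set} : Formula AP → Set where
  tt      : NegNormal tt
  atom    : ∀ p → NegNormal (atom p)
  negatom : ∀ p → NegNormal (¬' (atom p))
  and     : ∀ {φ ψ} → NegNormal φ → NegNormal ψ → NegNormal (φ ∧' ψ)
  or      : ∀ {φ ψ} → NegNormal φ → NegNormal ψ → NegNormal (φ ∨' ψ)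
  next    : ∀ {φ} → NegNormal φ → NegNormal (○ φ)
  until   : ∀ {φ ψ} → NegNormal φ → NegNormal ψ → NegNormal (φ U ψ)

-- Σ'-normal form for a formula whose atomic propositions are (by typing) in Σ'
Σ'-NormalForm : {Σ' : Set} → Formula Σ' → Set
Σ'-NormalForm = NegNormal

λ-Σ' : (Σ' : Set) → Labelling Σ' Σ'
λ-Σ' Σ' a p = p ≡ a

-- atomic propositions Σ' ∪ {ε}: just a ↦ a, nothing ↦ ε
ε : {Σ' : Set} → Maybe Σ'
ε = nothing

-- λ_{h_{ΣΣ'}}(a) = {h(a)}   (h a = nothing means h(a) is the empty word)
λ-h : {A B : Set} → (A → Maybe B) → Labelling A (Maybe B)
λ-h h a p = p ≡ h a

N : {Σ' : Set} → Formula Σ' → Formula (Maybe Σ')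
N tt = tt
N (atom a) = atom (just a)
N (¬' (atom a)) = (¬' atom (just a)) ∧' (¬' atom ε)
N (¬' φ) = ¬' N φ
N (φ ∧' ψ) = N φ ∧' N ψ
N (φ ∨' ψ) = N φ ∨' N ψ
N (○ φ) = ○ N φ
N (φ U ψ) = N φ U N ψ

-- h(x) = x' for the abstraction homomorphism generated by h : Σ → Σ' ∪ {ε}:
-- the non-ε letters of x occur at positions p 0 < p 1 < p 2 < … (infinitely
-- many, so h(x) is defined), they are mapped to x' 0, x' 1, …, and every
-- other position of x is mapped to ε.
AbsImage : {A B : Set} → (A → Maybe B) → ω-Word A → ω-Word B → Set
AbsImage h x x' =
  Σ (ℕ → ℕ) λ p →
    (∀ k → p k < p (suc k)) ×
    (∀ k → h (x (p k)) ≡ just (x' k)) ×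
    (∀ i → (∀ k → p k ≢ i) → h (x i) ≡ nothing)

{-# OPTIONS --safe #-}
module Submission where

-- A Boolean formula only reads the first letter. At a visible letter, one that
-- h maps to some b ∈ Σ', N η holds iff η holds at the words over Σ' starting
-- with b. At an ε-letter every literal of N η is false, so N η can hold there
-- only if η holds at every word. The first visible letter of x is x (p 0),
-- mapped to x' 0, and atom ε U N η cannot pass it: the until is witnessed
-- either at p 0 or at an ε-letter.

open import Defs
open import Data.Maybe using (Maybe; just; nothing)
open import Data.Maybe.Properties using (just-injective)
open import Function.Bundles using (_⇔_; mk⇔; Equivalence)
open import Data.Nat using (ℕ; zero; suc; _<_; _≤_)
open import Data.Nat.Properties using (≤-refl; ≤-trans; <⇒≤; <-≤-trans; <-irrefl; <-cmp; +-identityʳ)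
open import Data.Product using (_,_; proj₁; proj₂)
open import Data.Product.Function.NonDependent.Propositional using (_×-⇔_)
open import Data.Sum using (inj₁; inj₂)
open import Data.Sum.Function.Propositional using (_⊎-⇔_)
open import Data.Unit using (tt)
open import Relation.Binary.Definitions using (tri<; tri≈; tri>)
open import Relation.Binary.PropositionalEquality using (_≡_; _≢_; refl; sym; trans; cong)

suffix-head : {A : Set} (i : ℕ) (x : ω-Word A) → suffix i x 0 ≡ x i
suffix-head i x = cong x (+-identityʳ i)

module _ {A B : Set} (h : A → Maybe B) where

  ⊨-N⇔⊨ : ∀ {η} → Boolean η → NegNormal η → {y : ω-Word A} {z : ω-Word B} →
          h (y 0) ≡ just (z 0) → (z , λ-Σ' B ⊨ η) ⇔ (y , λ-h h ⊨ N η)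
  ⊨-N⇔⊨ _ tt _ = mk⇔ (λ _ → tt) (λ _ → tt)
  ⊨-N⇔⊨ _ (atom a) e =
    mk⇔ (λ a≡z₀ → trans (cong just a≡z₀) (sym e)) (λ a≡hy₀ → just-injective (trans a≡hy₀ e))
  ⊨-N⇔⊨ _ (negatom a) e =
    mk⇔ (λ a≢z₀ → (λ a≡hy₀ → a≢z₀ (just-injective (trans a≡hy₀ e)))
                 , (λ ε≡hy₀ → ε≢just (trans ε≡hy₀ e)))
        (λ (a≢hy₀ , _) a≡z₀ → a≢hy₀ (trans (cong just a≡z₀) (sym e)))
    where
    ε≢just : ∀ {b : B} → nothing ≢ just b
    ε≢just ()
  ⊨-N⇔⊨ (and bφ bψ) (and nφ nψ) e = ⊨-N⇔⊨ bφ nφ e ×-⇔ ⊨-N⇔⊨ bψ nψ e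
  ⊨-N⇔⊨ (or bφ bψ) (or nφ nψ) e = ⊨-N⇔⊨ bφ nφ e ⊎-⇔ ⊨-N⇔⊨ bψ nψ e

  ⊨-N-at-ε⇒⊨ : ∀ {η} → Boolean η → NegNormal η → {y : ω-Word A} (z : ω-Word B) →
               h (y 0) ≡ nothing → (y , λ-h h ⊨ N η) → (z , λ-Σ' B ⊨ η)
  ⊨-N-at-ε⇒⊨ _ tt _ _ _ = tt
  ⊨-N-at-ε⇒⊨ _ (atom a) _ e a≡hy₀ with () ← trans a≡hy₀ e
  ⊨-N-at-ε⇒⊨ _ (negatom a) _ e (_ , ε≢hy₀) with () ← ε≢hy₀ (sym e)
  ⊨-N-at-ε⇒⊨ (and bφ bψ) (and nφ nψ) z e (φ , ψ) =
    ⊨-N-at-ε⇒⊨ bφ nφ z e φ , ⊨-N-at-ε⇒⊨ bψ nψ z e ψ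
  ⊨-N-at-ε⇒⊨ (or bφ bψ) (or nφ nψ) z e (inj₁ φ) = inj₁ (⊨-N-at-ε⇒⊨ bφ nφ z e φ)
  ⊨-N-at-ε⇒⊨ (or bφ bψ) (or nφ nψ) z e (inj₂ ψ) = inj₂ (⊨-N-at-ε⇒⊨ bψ nψ z e ψ)

increasing⇒head-minimal : (p : ℕ → ℕ) → (∀ k → p k < p (suc k)) → ∀ k → p 0 ≤ p k
increasing⇒head-minimal p inc zero = ≤-refl
increasing⇒head-minimal p inc (suc k) = ≤-trans (increasing⇒head-minimal p inc k) (<⇒≤ (inc k))

module FirstVisible {A B : Set} (h : A → Maybe B) (x : ω-Word A) (x' : ω-Word B)
                    (img : AbsImage h x x') where

  private
    p : ℕ → ℕ
    p = proj₁ img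

    increasing : ∀ k → p k < p (suc k)
    increasing = proj₁ (proj₂ img)

    unlisted-ε : ∀ i → (∀ k → p k ≢ i) → h (x i) ≡ nothing
    unlisted-ε = proj₂ (proj₂ (proj₂ img))

  p₀ : ℕ
  p₀ = p 0

  x-at-p₀ : h (x p₀) ≡ just (x' 0)
  x-at-p₀ = proj₁ (proj₂ (proj₂ img)) 0

  ε-before-p₀ : ∀ j → j < p₀ → h (x j) ≡ nothing
  ε-before-p₀ j j<p₀ = unlisted-ε j λ k pₖ≡j →
    <-irrefl (sym pₖ≡j) (<-≤-trans j<p₀ (increasing⇒head-minimal p increasing k))

  first-visible≡p₀ : ∀ {i b} → h (x i) ≡ just b → (∀ j → j < i → h (x j) ≡ nothing) → i ≡ p₀
  first-visible≡p₀ {i} xᵢ-visible ε-before-i with <-cmp i p₀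
  ... | tri< i<p₀ _ _ with () ← trans (sym xᵢ-visible) (ε-before-p₀ i i<p₀)
  ... | tri≈ _ i≡p₀ _ = i≡p₀
  ... | tri> _ _ p₀<i with () ← trans (sym x-at-p₀) (ε-before-i p₀ p₀<i)

mainTheorem10 : (Σ Σ' : Set) (h : Σ → Maybe Σ') (x' : ω-Word Σ') (x : ω-Word Σ) →
                  AbsImage h x x' →
                  (η : Formula Σ') → Boolean η → Σ'-NormalForm η →
                  ((x' , λ-Σ' Σ' ⊨ η) ⇔ (x , λ-h h ⊨ (atom ε U N η)))
mainTheorem10 Σ Σ' h x' x img η bη nη = mk⇔ to from
  where
  open FirstVisible h x x' img

  letter-at : ∀ i → h (suffix i x 0) ≡ h (x i)
  letter-at i = cong h (suffix-head i x)

  ⊨-N-at-p₀ : (x' , λ-Σ' Σ' ⊨ η) ⇔ (suffix p₀ x , λ-h h ⊨ N η)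
  ⊨-N-at-p₀ = ⊨-N⇔⊨ h bη nη (trans (letter-at p₀) x-at-p₀)

  to : (x' , λ-Σ' Σ' ⊨ η) → (x , λ-h h ⊨ (atom ε U N η))
  to x'⊨η = p₀ , Equivalence.to ⊨-N-at-p₀ x'⊨η
               , λ j j<p₀ → sym (trans (letter-at j) (ε-before-p₀ j j<p₀))

  from : (x , λ-h h ⊨ (atom ε U N η)) → (x' , λ-Σ' Σ' ⊨ η)
  from (i , xᵢ⊨Nη , ε-before-i) with h (x i) in xᵢ-letter
  ... | nothing = ⊨-N-at-ε⇒⊨ h bη nη x' (trans (letter-at i) xᵢ-letter) xᵢ⊨Nη
  ... | just _ with refl ← first-visible≡p₀ xᵢ-letter (λ j j<i → sym (trans (ε-before-i j j<i) (letter-at j)))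
    = Equivalence.from ⊨-N-at-p₀ xᵢ⊨Nη
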